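{- Let $s\ge 1$ be an integer and let $f(x)\in\mathbb{Z}[x]$ be a polynomial of degree $s$ with leading coefficient $a_s$. Then for any two positive integers $m,n$ with $1\le m\le n$, $$\operatorname{lcm}(f(m),f(m+1),\ldots,f(n))\ge \frac{1}{(n-m)!}\prod_{k=m}^{n}\left|\frac{f(k)}{a_s}\right|^{1/s}.$$
   Context: $\operatorname{lcm}$ denotes the (nonnegative) least common multiple of the listed integers, which equals $0$ if one of them is $0$. -}

module Defs where

open import Data.Nat using (ℕ; zero; suc; _+_; _*_; _∸_)
open import Data.Nat.LCM using (lcm)
open import Data.Integer as ℤ using (ℤ; +_; ∣_∣)

open import Data.Vec using (Vec; foldr)
open import Data.List as L using (List; applyUpTo)
open import Data.Nat.ListAction using (product)

-- A polynomial with integer coefficients of formal degree ≤ s is given by its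
-- coefficient vector (a₀, a₁, …, a_s) : Vec ℤ (suc s).
Poly : ℕ → Set
Poly s = Vec ℤ (suc s)

eval : ∀ {s} → Poly s → ℤ → ℤ
eval {s} a x = foldr (λ _ → ℤ) (λ c acc → c ℤ.+ x ℤ.* acc) (+ 0) a

range : ℕ → ℕ → List ℕ
range m n = applyUpTo (λ i → m + i) (suc (n ∸ m))

-- lcm of a list of natural numbers (lcm of the empty list is 1); it is 0 iff
-- some entry is 0.
lcmList : List ℕ → ℕ
lcmList = L.foldr lcm 1

lcmVals : ∀ {s} → Poly s → ℕ → ℕ → ℕ
lcmVals a m n = lcmList (L.map (λ k → ∣ eval a (+ k) ∣) (range m n))

prodAbsVals : ∀ {s} → Poly s → ℕ → ℕ → ℕ
prodAbsVals a m n = product (L.map (λ k → ∣ eval a (+ k) ∣) (range m n))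

-- Let T = {m, …, n}, N = |T| and a the leading coefficient of f. For N ≥ s one has the identity
--   Σ_{S ⊆ T, |S| = s} ∏_{j ∈ T∖S} f(j) / ∏_{i ∈ S} (j − i) = a^{N−s},
-- by induction on T: the divided difference of f over s + 1 nodes is a, so adding a node t multiplies
-- the sum over subsets avoiding t by a up to correction terms, and by double counting and partial
-- fractions these are exactly cancelled by the subsets containing t.
-- Multiplied by (L (n − m)!)^s, L = lcm(f(m), …, f(n)), every summand becomes an integer multiple
-- of ∏_{k ∈ T} f(k): the product of the f(i), i ∈ S, divides L^s, and ∏_{j ∈ T∖{i}} |j − i| =
-- (i − m)! (n − i)! divides (n − m)!. So ∏ |f(k)| divides the nonzero (L (n − m)!)^s a^{N−s} unless some f(k) is 0.
-- For N < s, simply |f(k)| ≤ L.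

module Submission where

module RationalArithmetic where

  open import Data.Integer as ℤ using (ℤ; +_)
  import Data.Integer.Properties as ℤP
  open import Data.Rational as ℚ using (ℚ; 0ℚ; 1ℚ; _+_; _*_; -_; 1/_; _/_; toℚᵘ)
  open import Data.Rational.Properties as ℚP using (_≟_)
  import Data.Rational.Unnormalised as ℚᵘ
  import Data.Rational.Unnormalised.Properties as ℚᵘP
  open import Data.Empty using (⊥-elim)
  open import Relation.Nullary using (Dec; yes; no)
  open import Relation.Binary.PropositionalEquality
  open import Data.Rational.Solver using (module +-*-Solver)
  open +-*-Solver
  open ≡-Reasoning

  fromℤ : ℤ → ℚ
  fromℤ z = z / 1

  private
    toℚᵘ-fromℤ : ∀ z → toℚᵘ (fromℤ z) ℚᵘ.≃ ℚᵘ.mkℚᵘ z 0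
    toℚᵘ-fromℤ z = ℚP.toℚᵘ-fromℚᵘ (ℚᵘ.mkℚᵘ z 0)

  fromℤ-+ : ∀ x y → fromℤ (x ℤ.+ y) ≡ fromℤ x + fromℤ y
  fromℤ-+ x y = ℚP.toℚᵘ-injective (ℚᵘP.≃-trans (toℚᵘ-fromℤ (x ℤ.+ y))
    (ℚᵘP.≃-trans (ℚᵘ.*≡* (cong₂ ℤ._*_ (sym (cong₂ ℤ._+_ (ℤP.*-identityʳ x) (ℤP.*-identityʳ y))) refl))
    (ℚᵘP.≃-sym (ℚᵘP.≃-trans (ℚP.toℚᵘ-homo-+ (fromℤ x) (fromℤ y)) (ℚᵘP.+-cong (toℚᵘ-fromℤ x) (toℚᵘ-fromℤ y))))))

  fromℤ-* : ∀ x y → fromℤ (x ℤ.* y) ≡ fromℤ x * fromℤ y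
  fromℤ-* x y = ℚP.toℚᵘ-injective (ℚᵘP.≃-trans (toℚᵘ-fromℤ (x ℤ.* y))
    (ℚᵘP.≃-trans (ℚᵘ.*≡* refl)
    (ℚᵘP.≃-sym (ℚᵘP.≃-trans (ℚP.toℚᵘ-homo-* (fromℤ x) (fromℤ y)) (ℚᵘP.*-cong (toℚᵘ-fromℤ x) (toℚᵘ-fromℤ y))))))

  fromℤ-neg : ∀ x → fromℤ (ℤ.- x) ≡ - fromℤ x
  fromℤ-neg x = ℚP.toℚᵘ-injective (ℚᵘP.≃-trans (toℚᵘ-fromℤ (ℤ.- x))
    (ℚᵘP.≃-trans (ℚᵘ.*≡* refl)
    (ℚᵘP.≃-sym (ℚᵘP.≃-trans (ℚP.toℚᵘ-homo‿- (fromℤ x)) (ℚᵘP.-‿cong (toℚᵘ-fromℤ x))))))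

  fromℤ-injective : ∀ {x y} → fromℤ x ≡ fromℤ y → x ≡ y
  fromℤ-injective {x} {y} eq
    with ℚᵘP.≃-trans (ℚᵘP.≃-sym (toℚᵘ-fromℤ x)) (ℚᵘP.≃-trans (ℚP.toℚᵘ-cong eq) (toℚᵘ-fromℤ y))
  ... | ℚᵘ.*≡* e = trans (sym (ℤP.*-identityʳ x)) (trans e (ℤP.*-identityʳ y))

  -- A total inverse, with the junk value 0 ⁻¹ = 0; it makes ⁻¹ multiplicative without side conditions.
  infix 9 _⁻¹
  _⁻¹ : ℚ → ℚ
  p ⁻¹ with p ≟ 0ℚ
  ... | yes _ = 0ℚ
  ... | no p≢0 = (1/ p) {{ℚ.≢-nonZero p≢0}}

  ⁻¹-inverseʳ : ∀ p → p ≢ 0ℚ → p * p ⁻¹ ≡ 1ℚ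
  ⁻¹-inverseʳ p p≢0 with p ≟ 0ℚ
  ... | yes p≡0 = ⊥-elim (p≢0 p≡0)
  ... | no p≢0′ = ℚP.*-inverseʳ p {{ℚ.≢-nonZero p≢0′}}

  ⁻¹-unique : ∀ p q → p * q ≡ 1ℚ → p ⁻¹ ≡ q
  ⁻¹-unique p q pq = begin
    p ⁻¹                ≡⟨ sym (ℚP.*-identityʳ (p ⁻¹)) ⟩
    p ⁻¹ * 1ℚ           ≡⟨ cong (p ⁻¹ *_) (sym pq) ⟩
    p ⁻¹ * (p * q)      ≡⟨ sym (ℚP.*-assoc (p ⁻¹) p q) ⟩
    (p ⁻¹ * p) * q      ≡⟨ cong (_* q) (trans (ℚP.*-comm (p ⁻¹) p) (⁻¹-inverseʳ p p≢0)) ⟩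
    1ℚ * q              ≡⟨ ℚP.*-identityˡ q ⟩
    q ∎
    where
    p≢0 : p ≢ 0ℚ
    p≢0 refl = ℚP.1≢0 (trans (sym pq) (ℚP.*-zeroˡ q))

  *-cancelˡ-≡0 : ∀ p q → p ≢ 0ℚ → p * q ≡ 0ℚ → q ≡ 0ℚ
  *-cancelˡ-≡0 p q p≢0 pq = begin
    q                  ≡⟨ sym (ℚP.*-identityˡ q) ⟩
    1ℚ * q             ≡⟨ cong (_* q) (sym (trans (ℚP.*-comm (p ⁻¹) p) (⁻¹-inverseʳ p p≢0))) ⟩
    p ⁻¹ * p * q       ≡⟨ ℚP.*-assoc (p ⁻¹) p q ⟩
    p ⁻¹ * (p * q)     ≡⟨ cong (p ⁻¹ *_) pq ⟩
    p ⁻¹ * 0ℚ          ≡⟨ ℚP.*-zeroʳ (p ⁻¹) ⟩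
    0ℚ ∎

  *-≢0 : ∀ p q → p ≢ 0ℚ → q ≢ 0ℚ → p * q ≢ 0ℚ
  *-≢0 p q p≢0 q≢0 pq≡0 = q≢0 (*-cancelˡ-≡0 p q p≢0 pq≡0)

  ⁻¹-* : ∀ p q → (p * q) ⁻¹ ≡ p ⁻¹ * q ⁻¹
  ⁻¹-* p q = by-cases (p ≟ 0ℚ) (q ≟ 0ℚ)
    where
    by-cases : Dec (p ≡ 0ℚ) → Dec (q ≡ 0ℚ) → (p * q) ⁻¹ ≡ p ⁻¹ * q ⁻¹
    by-cases (yes refl) _ = trans (cong _⁻¹ (ℚP.*-zeroˡ q)) (sym (ℚP.*-zeroˡ (q ⁻¹)))
    by-cases (no _) (yes refl) = trans (cong _⁻¹ (ℚP.*-zeroʳ p)) (sym (ℚP.*-zeroʳ (p ⁻¹)))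
    by-cases (no p≢0) (no q≢0) = ⁻¹-unique (p * q) (p ⁻¹ * q ⁻¹) (begin
      p * q * (p ⁻¹ * q ⁻¹)     ≡⟨ solve 4 (λ p q a b → p :* q :* (a :* b) := (p :* a) :* (q :* b)) refl p q (p ⁻¹) (q ⁻¹) ⟩
      (p * p ⁻¹) * (q * q ⁻¹)   ≡⟨ cong₂ _*_ (⁻¹-inverseʳ p p≢0) (⁻¹-inverseʳ q q≢0) ⟩
      1ℚ ∎)

  ⁻¹-neg : ∀ p → (- p) ⁻¹ ≡ - p ⁻¹
  ⁻¹-neg p = by-cases (p ≟ 0ℚ)
    where
    by-cases : Dec (p ≡ 0ℚ) → (- p) ⁻¹ ≡ - p ⁻¹
    by-cases (yes refl) = refl
    by-cases (no p≢0) = ⁻¹-unique (- p) (- p ⁻¹)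
      (trans (solve 2 (λ p a → (:- p) :* (:- a) := p :* a) refl p (p ⁻¹)) (⁻¹-inverseʳ p p≢0))

  1⁻¹ : 1ℚ ⁻¹ ≡ 1ℚ
  1⁻¹ = ⁻¹-unique 1ℚ 1ℚ refl

module ListSums where

  open RationalArithmetic
  open import Data.Nat as ℕ using (ℕ; zero; suc)
  import Data.Nat.Properties as ℕP
  open import Data.List using (List; []; _∷_; length)
  open import Data.List.Relation.Unary.All as All using (All; []; _∷_)
  open import Data.List.Relation.Unary.AllPairs using ([]; _∷_)
  open import Data.List.Relation.Unary.Unique.Propositional using (Unique)
  open import Data.Product using (_×_; _,_)
  open import Data.Rational using (ℚ; 0ℚ; 1ℚ; _+_; _*_; -_; _-_)
  import Data.Rational.Properties as ℚP
  open import Relation.Binary.PropositionalEquality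
  open import Data.Rational.Solver using (module +-*-Solver)
  open +-*-Solver
  open ≡-Reasoning

  ∏ : {A : Set} → (A → ℚ) → List A → ℚ
  ∏ g [] = 1ℚ
  ∏ g (x ∷ xs) = g x * ∏ g xs

  ∏-cong : ∀ {a b : ℕ → ℚ} R → (∀ j → a j ≡ b j) → ∏ a R ≡ ∏ b R
  ∏-cong [] h = refl
  ∏-cong (x ∷ R) h = cong₂ _*_ (h x) (∏-cong R h)

  ∏-* : ∀ (a b : ℕ → ℚ) R → ∏ (λ j → a j * b j) R ≡ ∏ a R * ∏ b R
  ∏-* a b [] = refl
  ∏-* a b (x ∷ R) = trans (cong (a x * b x *_) (∏-* a b R))
    (solve 4 (λ a b c d → a :* b :* (c :* d) := a :* c :* (b :* d)) refl (a x) (b x) (∏ a R) (∏ b R))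

  ∏-⁻¹ : ∀ (h : ℕ → ℚ) R → ∏ (λ j → h j ⁻¹) R ≡ (∏ h R) ⁻¹
  ∏-⁻¹ h [] = sym 1⁻¹
  ∏-⁻¹ h (x ∷ R) = trans (cong (h x ⁻¹ *_) (∏-⁻¹ h R)) (sym (⁻¹-* (h x) (∏ h R)))

  ∏-≢0 : ∀ (h : ℕ → ℚ) R → All (λ j → h j ≢ 0ℚ) R → ∏ h R ≢ 0ℚ
  ∏-≢0 h [] [] = λ ()
  ∏-≢0 h (x ∷ R) (p ∷ ps) = *-≢0 (h x) (∏ h R) p (∏-≢0 h R ps)

  data Pick : List ℕ → ℕ → List ℕ → Set where
    here  : ∀ {w U} → Pick (w ∷ U) w U
    there : ∀ {w U u r} → Pick U u r → Pick (w ∷ U) u (w ∷ r)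

  ΣPick : (ℕ → List ℕ → ℚ) → List ℕ → ℚ
  ΣPick F [] = 0ℚ
  ΣPick F (w ∷ U) = F w U + ΣPick (λ u r → F u (w ∷ r)) U

  ΣPick-cong : ∀ U {F G : ℕ → List ℕ → ℚ} → (∀ {u r} → Pick U u r → F u r ≡ G u r) → ΣPick F U ≡ ΣPick G U
  ΣPick-cong [] h = refl
  ΣPick-cong (w ∷ U) h = cong₂ _+_ (h here) (ΣPick-cong U (λ p → h (there p)))

  ΣPick-+ : ∀ U (F G : ℕ → List ℕ → ℚ) → ΣPick (λ u r → F u r + G u r) U ≡ ΣPick F U + ΣPick G U
  ΣPick-+ [] F G = refl
  ΣPick-+ (w ∷ U) F G = trans (cong (F w U + G w U +_) (ΣPick-+ U _ _))
    (solve 4 (λ a b c d → a :+ b :+ (c :+ d) := a :+ c :+ (b :+ d)) refl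
      (F w U) (G w U) (ΣPick (λ u r → F u (w ∷ r)) U) (ΣPick (λ u r → G u (w ∷ r)) U))

  ΣPick-scale : ∀ U (c : ℚ) (F : ℕ → List ℕ → ℚ) → ΣPick (λ u r → c * F u r) U ≡ c * ΣPick F U
  ΣPick-scale [] c F = sym (ℚP.*-zeroʳ c)
  ΣPick-scale (w ∷ U) c F = trans (cong (c * F w U +_) (ΣPick-scale U c _)) (sym (ℚP.*-distribˡ-+ c _ _))

  pick-All : ∀ {P : ℕ → Set} {U u r} → All P U → Pick U u r → P u × All P r
  pick-All (pu ∷ ps) here = pu , ps
  pick-All (pw ∷ ps) (there p) = let (pu , pr) = pick-All ps p in pu , pw ∷ pr

  pick-length : ∀ {U u r} → Pick U u r → length U ≡ suc (length r)
  pick-length here = refl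
  pick-length (there p) = cong suc (pick-length p)

  ∏-pick : ∀ {U u r} (g : ℕ → ℚ) → Pick U u r → ∏ g U ≡ g u * ∏ g r
  ∏-pick g here = refl
  ∏-pick {w ∷ U} {u} {w ∷ r} g (there p) = trans (cong (g w *_) (∏-pick g p))
    (solve 3 (λ a b c → a :* (b :* c) := b :* (a :* c)) refl (g w) (g u) (∏ g r))

  data Split : ℕ → List ℕ → List ℕ → List ℕ → Set where
    done : ∀ {T} → Split 0 T [] T
    skip : ∀ {k T S R x} → Split (suc k) T S R → Split (suc k) (x ∷ T) S (x ∷ R)
    take : ∀ {k T S R x} → Split k T S R → Split (suc k) (x ∷ T) (x ∷ S) R

  ΣSplit : ℕ → (List ℕ → List ℕ → ℚ) → List ℕ → ℚ
  ΣSplit zero G T = G [] T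
  ΣSplit (suc k) G [] = 0ℚ
  ΣSplit (suc k) G (x ∷ T) = ΣSplit (suc k) (λ S R → G S (x ∷ R)) T + ΣSplit k (λ S R → G (x ∷ S) R) T

  ΣSplit-cong : ∀ k T {F G : List ℕ → List ℕ → ℚ} → (∀ {S R} → Split k T S R → F S R ≡ G S R) →
                ΣSplit k F T ≡ ΣSplit k G T
  ΣSplit-cong zero T h = h done
  ΣSplit-cong (suc k) [] h = refl
  ΣSplit-cong (suc k) (x ∷ T) h =
    cong₂ _+_ (ΣSplit-cong (suc k) T (λ c → h (skip c))) (ΣSplit-cong k T (λ c → h (take c)))

  ΣSplit-+ : ∀ k T (F G : List ℕ → List ℕ → ℚ) → ΣSplit k (λ S R → F S R + G S R) T ≡ ΣSplit k F T + ΣSplit k G T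
  ΣSplit-+ zero T F G = refl
  ΣSplit-+ (suc k) [] F G = refl
  ΣSplit-+ (suc k) (x ∷ T) F G = trans (cong₂ _+_ (ΣSplit-+ (suc k) T _ _) (ΣSplit-+ k T _ _))
    (solve 4 (λ a b c d → a :+ b :+ (c :+ d) := a :+ c :+ (b :+ d)) refl
      (ΣSplit (suc k) (λ S R → F S (x ∷ R)) T) (ΣSplit (suc k) (λ S R → G S (x ∷ R)) T)
      (ΣSplit k (λ S R → F (x ∷ S) R) T) (ΣSplit k (λ S R → G (x ∷ S) R) T))

  ΣSplit-scale : ∀ k T (c : ℚ) (F : List ℕ → List ℕ → ℚ) → ΣSplit k (λ S R → c * F S R) T ≡ c * ΣSplit k F T
  ΣSplit-scale zero T c F = refl
  ΣSplit-scale (suc k) [] c F = sym (ℚP.*-zeroʳ c)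
  ΣSplit-scale (suc k) (x ∷ T) c F =
    trans (cong₂ _+_ (ΣSplit-scale (suc k) T c _) (ΣSplit-scale k T c _)) (sym (ℚP.*-distribˡ-+ c _ _))

  ΣSplit-- : ∀ k T (F G : List ℕ → List ℕ → ℚ) → ΣSplit k (λ S R → F S R - G S R) T ≡ ΣSplit k F T - ΣSplit k G T
  ΣSplit-- k T F G = begin
    ΣSplit k (λ S R → F S R - G S R) T
      ≡⟨ ΣSplit-cong k T (λ {S} {R} _ → solve 2 (λ a b → a :- b := a :+ (:- con 1ℚ) :* b) refl (F S R) (G S R)) ⟩
    ΣSplit k (λ S R → F S R + (- 1ℚ) * G S R) T
      ≡⟨ ΣSplit-+ k T F (λ S R → (- 1ℚ) * G S R) ⟩
    ΣSplit k F T + ΣSplit k (λ S R → (- 1ℚ) * G S R) T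
      ≡⟨ cong (_+_ (ΣSplit k F T)) (ΣSplit-scale k T (- 1ℚ) G) ⟩
    ΣSplit k F T + (- 1ℚ) * ΣSplit k G T
      ≡⟨ solve 2 (λ a b → a :+ (:- con 1ℚ) :* b := a :- b) refl (ΣSplit k F T) (ΣSplit k G T) ⟩
    ΣSplit k F T - ΣSplit k G T ∎

  ΣSplit-short : ∀ k T (F : List ℕ → List ℕ → ℚ) → length T ℕ.< k → ΣSplit k F T ≡ 0ℚ
  ΣSplit-short (suc k) [] F _ = refl
  ΣSplit-short (suc k) (x ∷ T) F (ℕ.s≤s |T|<k) =
    cong₂ _+_ (ΣSplit-short (suc k) T _ (ℕP.m<n⇒m<1+n |T|<k)) (ΣSplit-short k T _ |T|<k)

  ΣSplit-all : ∀ T (F : List ℕ → List ℕ → ℚ) → ΣSplit (length T) F T ≡ F T []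
  ΣSplit-all [] F = refl
  ΣSplit-all (x ∷ T) F = begin
    ΣSplit (suc (length T)) (λ S R → F S (x ∷ R)) T + ΣSplit (length T) (λ S R → F (x ∷ S) R) T
      ≡⟨ cong (_+ ΣSplit (length T) (λ S R → F (x ∷ S) R) T) (ΣSplit-short (suc (length T)) T _ (ℕP.n<1+n _)) ⟩
    0ℚ + ΣSplit (length T) (λ S R → F (x ∷ S) R) T
      ≡⟨ ℚP.+-identityˡ _ ⟩
    ΣSplit (length T) (λ S R → F (x ∷ S) R) T
      ≡⟨ ΣSplit-all T _ ⟩
    F (x ∷ T) [] ∎

  split-All : ∀ {P : ℕ → Set} {k T S R} → All P T → Split k T S R → All P S × All P R
  split-All ps done = [] , ps
  split-All (px ∷ ps) (skip c) = let (pS , pR) = split-All ps c in pS , px ∷ pR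
  split-All (px ∷ ps) (take c) = let (pS , pR) = split-All ps c in px ∷ pS , pR

  split-unique : ∀ {k T S R} → Unique T → Split k T S R →
                 Unique S × Unique R × All (λ j → All (j ≢_) S) R
  split-unique uniq done = [] , uniq , All.tabulate (λ _ → [])
  split-unique (x∉T ∷ uniq) (skip c) with split-unique uniq c | split-All x∉T c
  ... | (uniq-S , uniq-R , R∉S) | (x∉S , x∉R) = uniq-S , x∉R ∷ uniq-R , x∉S ∷ R∉S
  split-unique (x∉T ∷ uniq) (take c) with split-unique uniq c | split-All x∉T c
  ... | (uniq-S , uniq-R , R∉S) | (x∉S , x∉R) =
    x∉S ∷ uniq-S , uniq-R , All.zipWith (λ (x≢j , j∉S) → (λ j≡x → x≢j (sym j≡x)) ∷ j∉S) (x∉R , R∉S)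

  split-length : ∀ {k T S R} → Split k T S R → length S ≡ k
  split-length done = refl
  split-length (skip c) = split-length c
  split-length (take c) = cong suc (split-length c)

  split-length-rest : ∀ {k T S R} → Split k T S R → length T ≡ k ℕ.+ length R
  split-length-rest done = refl
  split-length-rest {suc k} {x ∷ T} {S} {x ∷ R} (skip c) =
    trans (cong suc (split-length-rest c)) (sym (ℕP.+-suc (suc k) (length R)))
  split-length-rest (take c) = cong suc (split-length-rest c)

  ∏-split : ∀ {k T S R} (g : ℕ → ℚ) → Split k T S R → ∏ g T ≡ ∏ g S * ∏ g R
  ∏-split g done = sym (ℚP.*-identityˡ _)
  ∏-split {T = x ∷ T} {S} {x ∷ R} g (skip c) = trans (cong (g x *_) (∏-split g c))
    (solve 3 (λ a b c → a :* (b :* c) := b :* (a :* c)) refl (g x) (∏ g S) (∏ g R))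
  ∏-split {T = x ∷ T} {x ∷ S} {R} g (take c) = trans (cong (g x *_) (∏-split g c)) (sym (ℚP.*-assoc (g x) (∏ g S) (∏ g R)))

  -- Double counting: a (k+1)-subset with a marked element i is the same as a k-subset S′
  -- together with an element i of its complement.
  ΣSplit-ΣPick-exchange : ∀ T k (K : List ℕ → ℕ → List ℕ → ℚ) →
    ΣSplit (suc k) (λ S R → ΣPick (λ i S′ → K S′ i R) S) T ≡ ΣSplit k (λ S′ R′ → ΣPick (λ i R → K S′ i R) R′) T
  ΣSplit-ΣPick-exchange [] zero K = refl
  ΣSplit-ΣPick-exchange [] (suc k) K = refl
  ΣSplit-ΣPick-exchange (x ∷ T) zero K = begin
    ΣSplit 1 (λ S R → ΣPick (λ i S′ → K S′ i (x ∷ R)) S) T + (K [] x T + 0ℚ)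
      ≡⟨ cong (_+ (K [] x T + 0ℚ)) (ΣSplit-ΣPick-exchange T zero (λ S i R → K S i (x ∷ R))) ⟩
    ΣPick (λ i R → K [] i (x ∷ R)) T + (K [] x T + 0ℚ)
      ≡⟨ solve 2 (λ a b → a :+ (b :+ con 0ℚ) := b :+ a) refl (ΣPick (λ i R → K [] i (x ∷ R)) T) (K [] x T) ⟩
    K [] x T + ΣPick (λ i R → K [] i (x ∷ R)) T ∎
  ΣSplit-ΣPick-exchange (x ∷ T) (suc k) K = begin
    ΣSplit (suc (suc k)) (λ S R → ΣPick (λ i S′ → K S′ i (x ∷ R)) S) T
      + ΣSplit (suc k) (λ S R → K S x R + ΣPick (λ i S′ → K (x ∷ S′) i R) S) T
      ≡⟨ cong₂ _+_ (ΣSplit-ΣPick-exchange T (suc k) (λ S i R → K S i (x ∷ R))) (ΣSplit-+ (suc k) T _ _) ⟩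
    a + (b + ΣSplit (suc k) (λ S R → ΣPick (λ i S′ → K (x ∷ S′) i R) S) T)
      ≡⟨ cong (λ z → a + (b + z)) (ΣSplit-ΣPick-exchange T k (λ S i R → K (x ∷ S) i R)) ⟩
    a + (b + c)
      ≡⟨ solve 3 (λ a b c → a :+ (b :+ c) := b :+ a :+ c) refl a b c ⟩
    (b + a) + c
      ≡⟨ cong (_+ c) (sym (ΣSplit-+ (suc k) T _ _)) ⟩
    ΣSplit (suc k) (λ S R → K S x R + ΣPick (λ i R₁ → K S i (x ∷ R₁)) R) T + c ∎
    where
    a b c : ℚ
    a = ΣSplit (suc k) (λ S′ R′ → ΣPick (λ i R → K S′ i (x ∷ R)) R′) T
    b = ΣSplit (suc k) (λ S R → K S x R) T
    c = ΣSplit k (λ S R → ΣPick (λ i R₁ → K (x ∷ S) i R₁) R) T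

module DividedDifferences where

  open RationalArithmetic
  open ListSums
  open import Data.Nat as ℕ using (ℕ; zero; suc)
  import Data.Nat.Properties as ℕP
  open import Data.Integer using (+_)
  import Data.Integer.Properties as ℤP
  open import Data.List using (List; []; _∷_; length)
  open import Data.List.Relation.Unary.All using (All; []; _∷_)
  open import Data.List.Relation.Unary.AllPairs using ([]; _∷_)
  open import Data.List.Relation.Unary.Unique.Propositional using (Unique)
  open import Data.Vec using (Vec; lookup) renaming ([] to []ᵥ; _∷_ to _∷ᵥ_)
  open import Data.Fin using (fromℕ)
  open import Data.Product using (_×_; _,_; proj₁; proj₂)
  open import Data.Rational as ℚ using (ℚ; 0ℚ; 1ℚ; _+_; _*_; -_; _-_)
  import Data.Rational.Properties as ℚP
  open import Algebra.Definitions.RawSemiring ℚ.+-*-rawSemiring using (_^_)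
  open import Relation.Binary.PropositionalEquality
  open import Data.Rational.Solver using (module +-*-Solver)
  open +-*-Solver
  open ≡-Reasoning

  toℚ : ℕ → ℚ
  toℚ j = fromℤ (+ j)

  toℚ-injective : ∀ {u v} → toℚ u ≡ toℚ v → u ≡ v
  toℚ-injective {u} {v} eq = ℤP.+-injective (fromℤ-injective {+ u} {+ v} eq)

  diff : ℕ → ℕ → ℚ
  diff u v = toℚ u - toℚ v

  diff-≢0 : ∀ {u v} → u ≢ v → diff u v ≢ 0ℚ
  diff-≢0 {u} {v} u≢v u-v≡0 = u≢v (toℚ-injective (begin
    toℚ u              ≡⟨ solve 2 (λ a b → a := (a :- b) :+ b) refl (toℚ u) (toℚ v) ⟩
    diff u v + toℚ v   ≡⟨ cong (_+ toℚ v) u-v≡0 ⟩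
    0ℚ + toℚ v         ≡⟨ ℚP.+-identityˡ (toℚ v) ⟩
    toℚ v ∎))

  weight : ℕ → List ℕ → ℚ
  weight u r = (∏ (diff u) r) ⁻¹

  weight-∷ : ∀ u w r → weight u (w ∷ r) ≡ (diff u w) ⁻¹ * weight u r
  weight-∷ u w r = ⁻¹-* (diff u w) (∏ (diff u) r)

  divDiff : (ℕ → ℚ) → List ℕ → ℚ
  divDiff h U = ΣPick (λ u r → h u * weight u r) U

  monomial : ℕ → ℕ → ℚ
  monomial j u = toℚ u ^ j

  divDiff-monomial-suc : ∀ j w U → All (w ≢_) U →
    divDiff (monomial (suc j)) (w ∷ U) ≡ divDiff (monomial j) U + toℚ w * divDiff (monomial j) (w ∷ U)
  divDiff-monomial-suc j w U w∉U = begin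
    toℚ w * P * V + ΣPick A U
      ≡⟨ cong (_+_ (toℚ w * P * V)) (ΣPick-cong U split-term) ⟩
    toℚ w * P * V + ΣPick (λ u r → B u r + toℚ w * C u r) U
      ≡⟨ cong (_+_ (toℚ w * P * V)) (trans (ΣPick-+ U B _) (cong (_+_ (ΣPick B U)) (ΣPick-scale U (toℚ w) C))) ⟩
    toℚ w * P * V + (ΣPick B U + toℚ w * ΣPick C U)
      ≡⟨ solve 5 (λ q P V b c → q :* P :* V :+ (b :+ q :* c) := b :+ q :* (P :* V :+ c)) refl
           (toℚ w) P V (ΣPick B U) (ΣPick C U) ⟩
    ΣPick B U + toℚ w * (P * V + ΣPick C U) ∎
    where
    P V : ℚ
    P = monomial j w
    V = weight w U
    A B C : ℕ → List ℕ → ℚ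
    A u r = monomial (suc j) u * weight u (w ∷ r)
    B u r = monomial j u * weight u r
    C u r = monomial j u * weight u (w ∷ r)
    -- u^{j+1} = (u − w) u^j + w u^j, and the factor u − w cancels against the weight.
    split-term : ∀ {u r} → Pick U u r → A u r ≡ B u r + toℚ w * C u r
    split-term {u} {r} p = begin
      toℚ u * X * weight u (w ∷ r)
        ≡⟨ cong (toℚ u * X *_) (weight-∷ u w r) ⟩
      toℚ u * X * (I * Y)
        ≡⟨ solve 5 (λ a b X I Y → a :* X :* (I :* Y) := ((a :- b) :* I) :* (X :* Y) :+ b :* (X :* (I :* Y))) refl
             (toℚ u) (toℚ w) X I Y ⟩
      (diff u w * I) * (X * Y) + toℚ w * (X * (I * Y))
        ≡⟨ cong₂ (λ a b → a * (X * Y) + toℚ w * (X * b)) (⁻¹-inverseʳ (diff u w) (diff-≢0 u≢w)) (sym (weight-∷ u w r)) ⟩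
      1ℚ * (X * Y) + toℚ w * C u r
        ≡⟨ cong (_+ toℚ w * C u r) (ℚP.*-identityˡ (X * Y)) ⟩
      B u r + toℚ w * C u r ∎
      where
      X I Y : ℚ
      X = monomial j u
      I = (diff u w) ⁻¹
      Y = weight u r
      u≢w : u ≢ w
      u≢w u≡w = proj₁ (pick-All w∉U p) (sym u≡w)

  divDiff-singleton : ∀ h w → divDiff h (w ∷ []) ≡ h w
  divDiff-singleton h w = trans (cong (λ z → h w * z + 0ℚ) 1⁻¹)
    (solve 1 (λ a → a :* con 1ℚ :+ con 0ℚ := a) refl (h w))

  divDiff-swap : ∀ h w w′ V → divDiff h (w ∷ w′ ∷ V) ≡ divDiff h (w′ ∷ w ∷ V)
  divDiff-swap h w w′ V =
    trans (cong (λ z → a + (b + z)) (ΣPick-cong V (λ {u} {r} _ → cong (λ z → h u * z ⁻¹)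
        (solve 3 (λ a b c → a :* (b :* c) := b :* (a :* c)) refl (diff u w) (diff u w′) (∏ (diff u) r)))))
      (solve 3 (λ a b c → a :+ (b :+ c) := b :+ (a :+ c)) refl a b _)
    where
    a b : ℚ
    a = h w * weight w (w′ ∷ V)
    b = h w′ * weight w′ (w ∷ V)

  -- Mutual induction: 1[w′, V] = 1[w, V], so expanding x[w, w′, V] = x[w′, w, V] with
  -- divDiff-monomial-suc gives (w − w′) · 1[w, w′, V] = 0.
  divDiff-1-head : ∀ V w w′ → All (w ≢_) V → All (w′ ≢_) V → Unique V →
                   divDiff (monomial 0) (w′ ∷ V) ≡ divDiff (monomial 0) (w ∷ V)
  divDiff-1-≡0 : ∀ V w w′ → Unique (w ∷ w′ ∷ V) → divDiff (monomial 0) (w ∷ w′ ∷ V) ≡ 0ℚ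

  divDiff-1-head [] w w′ _ _ _ =
    trans (divDiff-singleton (monomial 0) w′) (sym (divDiff-singleton (monomial 0) w))
  divDiff-1-head (x ∷ V) w w′ (w≢x ∷ w∉V) (w′≢x ∷ w′∉V) uniq =
    trans (divDiff-1-≡0 V w′ x ((w′≢x ∷ w′∉V) ∷ uniq)) (sym (divDiff-1-≡0 V w x ((w≢x ∷ w∉V) ∷ uniq)))

  divDiff-1-≡0 V w w′ ((w≢w′ ∷ w∉V) ∷ (w′∉V ∷ uniq)) = *-cancelˡ-≡0 (diff w w′) X (diff-≢0 w≢w′) (begin
    diff w w′ * X
      ≡⟨ solve 4 (λ a b e X → (a :- b) :* X := (e :+ a :* X) :- (e :+ b :* X)) refl (toℚ w) (toℚ w′) Y X ⟩
    (Y + toℚ w * X) - (Y + toℚ w′ * X)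
      ≡⟨ cong (_- (Y + toℚ w′ * X)) same-first-order ⟩
    (Y + toℚ w′ * X) - (Y + toℚ w′ * X)
      ≡⟨ ℚP.+-inverseʳ (Y + toℚ w′ * X) ⟩
    0ℚ ∎)
    where
    X Y : ℚ
    X = divDiff (monomial 0) (w ∷ w′ ∷ V)
    Y = divDiff (monomial 0) (w ∷ V)
    same-first-order : Y + toℚ w * X ≡ Y + toℚ w′ * X
    same-first-order = begin
      Y + toℚ w * X
        ≡⟨ cong (_+ toℚ w * X) (sym (divDiff-1-head V w w′ w∉V w′∉V uniq)) ⟩
      divDiff (monomial 0) (w′ ∷ V) + toℚ w * X
        ≡⟨ sym (divDiff-monomial-suc 0 w (w′ ∷ V) (w≢w′ ∷ w∉V)) ⟩
      divDiff (monomial 1) (w ∷ w′ ∷ V)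
        ≡⟨ divDiff-swap (monomial 1) w w′ V ⟩
      divDiff (monomial 1) (w′ ∷ w ∷ V)
        ≡⟨ divDiff-monomial-suc 0 w′ (w ∷ V) ((λ w′≡w → w≢w′ (sym w′≡w)) ∷ w′∉V) ⟩
      Y + toℚ w′ * divDiff (monomial 0) (w′ ∷ w ∷ V)
        ≡⟨ cong (λ z → Y + toℚ w′ * z) (sym (divDiff-swap (monomial 0) w w′ V)) ⟩
      Y + toℚ w′ * X ∎

  divDiff-monomial : ∀ U w → Unique (w ∷ U) →
    (∀ j → j ℕ.< length U → divDiff (monomial j) (w ∷ U) ≡ 0ℚ) × divDiff (monomial (length U)) (w ∷ U) ≡ 1ℚ
  divDiff-monomial [] w _ = (λ j ()) , divDiff-singleton (monomial 0) w
  divDiff-monomial (x ∷ V) w (w∉xV ∷ uniq) = below , top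
    where
    ih-below : ∀ j → j ℕ.< length V → divDiff (monomial j) (x ∷ V) ≡ 0ℚ
    ih-below = proj₁ (divDiff-monomial V x uniq)
    below : ∀ j → j ℕ.< suc (length V) → divDiff (monomial j) (w ∷ x ∷ V) ≡ 0ℚ
    below zero _ = divDiff-1-≡0 V w x (w∉xV ∷ uniq)
    below (suc j) (ℕ.s≤s j<|V|) = trans (divDiff-monomial-suc j w (x ∷ V) w∉xV)
      (trans (cong₂ (λ a b → a + toℚ w * b) (ih-below j j<|V|) (below j (ℕP.m<n⇒m<1+n j<|V|)))
        (solve 1 (λ a → con 0ℚ :+ a :* con 0ℚ := con 0ℚ) refl (toℚ w)))
    top : divDiff (monomial (suc (length V))) (w ∷ x ∷ V) ≡ 1ℚ
    top = trans (divDiff-monomial-suc (length V) w (x ∷ V) w∉xV)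
      (trans (cong₂ (λ a b → a + toℚ w * b) (proj₂ (divDiff-monomial V x uniq)) (below (length V) (ℕP.n<1+n _)))
        (solve 1 (λ a → con 1ℚ :+ a :* con 0ℚ := con 1ℚ) refl (toℚ w)))

  evalℚ : ∀ {n} → Vec ℚ n → ℚ → ℚ
  evalℚ []ᵥ x = 0ℚ
  evalℚ (c ∷ᵥ cs) x = c + x * evalℚ cs x

  divDiff-poly : ∀ n (c : Vec ℚ (suc n)) j U → Unique U → length U ≡ suc (j ℕ.+ n) →
                 divDiff (λ u → monomial j u * evalℚ c (toℚ u)) U ≡ lookup c (fromℕ n)
  divDiff-poly zero (κ ∷ᵥ []ᵥ) j (w ∷ U′) uniq |U|≡ = begin
    divDiff (λ u → monomial j u * evalℚ (κ ∷ᵥ []ᵥ) (toℚ u)) (w ∷ U′)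
      ≡⟨ ΣPick-cong (w ∷ U′) (λ {u} {r} _ → solve 4 (λ P c x W → P :* (c :+ x :* con 0ℚ) :* W := c :* (P :* W)) refl
           (monomial j u) κ (toℚ u) (weight u r)) ⟩
    ΣPick (λ u r → κ * (monomial j u * weight u r)) (w ∷ U′)
      ≡⟨ ΣPick-scale (w ∷ U′) κ (λ u r → monomial j u * weight u r) ⟩
    κ * divDiff (monomial j) (w ∷ U′)
      ≡⟨ cong (λ i → κ * divDiff (monomial i) (w ∷ U′)) j≡|U′| ⟩
    κ * divDiff (monomial (length U′)) (w ∷ U′)
      ≡⟨ cong (κ *_) (proj₂ (divDiff-monomial U′ w uniq)) ⟩
    κ * 1ℚ
      ≡⟨ ℚP.*-identityʳ κ ⟩
    κ ∎
    where
    j≡|U′| : j ≡ length U′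
    j≡|U′| = trans (sym (ℕP.+-identityʳ j)) (sym (ℕP.suc-injective |U|≡))
  divDiff-poly (suc n) (κ ∷ᵥ c) j (w ∷ U′) uniq |U|≡ = begin
    divDiff (λ u → monomial j u * evalℚ (κ ∷ᵥ c) (toℚ u)) (w ∷ U′)
      ≡⟨ ΣPick-cong (w ∷ U′) (λ {u} {r} _ → solve 5 (λ P c x e W → P :* (c :+ x :* e) :* W := c :* (P :* W) :+ (x :* P) :* e :* W) refl
           (monomial j u) κ (toℚ u) (evalℚ c (toℚ u)) (weight u r)) ⟩
    ΣPick (λ u r → κ * (monomial j u * weight u r) + monomial (suc j) u * evalℚ c (toℚ u) * weight u r) (w ∷ U′)
      ≡⟨ ΣPick-+ (w ∷ U′) (λ u r → κ * (monomial j u * weight u r)) (λ u r → monomial (suc j) u * evalℚ c (toℚ u) * weight u r) ⟩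
    ΣPick (λ u r → κ * (monomial j u * weight u r)) (w ∷ U′) + divDiff (λ u → monomial (suc j) u * evalℚ c (toℚ u)) (w ∷ U′)
      ≡⟨ cong₂ _+_ (ΣPick-scale (w ∷ U′) κ (λ u r → monomial j u * weight u r)) (divDiff-poly n c (suc j) (w ∷ U′) uniq |U|≡′) ⟩
    κ * divDiff (monomial j) (w ∷ U′) + lookup c (fromℕ n)
      ≡⟨ cong (λ z → κ * z + lookup c (fromℕ n)) (proj₁ (divDiff-monomial U′ w uniq) j j<|U′|) ⟩
    κ * 0ℚ + lookup c (fromℕ n)
      ≡⟨ solve 2 (λ c l → c :* con 0ℚ :+ l := l) refl κ (lookup c (fromℕ n)) ⟩
    lookup c (fromℕ n) ∎
    where
    |U|≡′ : suc (length U′) ≡ suc (suc j ℕ.+ n)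
    |U|≡′ = trans |U|≡ (cong suc (ℕP.+-suc j n))
    j<|U′| : j ℕ.< length U′
    j<|U′| = subst (j ℕ.<_) (sym (ℕP.suc-injective |U|≡)) (ℕP.m<m+n j (ℕ.s≤s ℕ.z≤n))

  private
    sign : ℕ → ℚ
    sign k = (- 1ℚ) ^ k

    sign-⁻¹ : ∀ k → (sign k) ⁻¹ ≡ sign k
    sign-⁻¹ zero = 1⁻¹
    sign-⁻¹ (suc k) = trans (⁻¹-* (- 1ℚ) (sign k)) (cong₂ _*_ (trans (⁻¹-neg 1ℚ) (cong -_ 1⁻¹)) (sign-⁻¹ k))

    ∏-diff-flip : ∀ u r → ∏ (λ v → diff v u) r ≡ sign (length r) * ∏ (diff u) r
    ∏-diff-flip u [] = refl
    ∏-diff-flip u (v ∷ r) = trans (cong (diff v u *_) (∏-diff-flip u r))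
      (solve 4 (λ a b s P → (b :- a) :* (s :* P) := ((:- con 1ℚ) :* s) :* ((a :- b) :* P)) refl
        (toℚ u) (toℚ v) (sign (length r)) (∏ (diff u) r))

  -- With the differences taken the other way round the weights acquire the common sign (−1)^{|V|+1},
  -- so this is the divided difference of 1 over at least two nodes.
  ΣPick-flipped-weights-≡0 : ∀ w x V → Unique (w ∷ x ∷ V) →
    ΣPick (λ u r → (∏ (λ v → diff v u) r) ⁻¹) (w ∷ x ∷ V) ≡ 0ℚ
  ΣPick-flipped-weights-≡0 w x V uniq = begin
    ΣPick (λ u r → (∏ (λ v → diff v u) r) ⁻¹) U
      ≡⟨ ΣPick-cong U flip-term ⟩
    ΣPick (λ u r → ε * (monomial 0 u * weight u r)) U
      ≡⟨ ΣPick-scale U ε (λ u r → monomial 0 u * weight u r) ⟩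
    ε * divDiff (monomial 0) U
      ≡⟨ cong (ε *_) (divDiff-1-≡0 V w x uniq) ⟩
    ε * 0ℚ
      ≡⟨ ℚP.*-zeroʳ ε ⟩
    0ℚ ∎
    where
    U : List ℕ
    U = w ∷ x ∷ V
    ε : ℚ
    ε = sign (suc (length V))
    flip-term : ∀ {u r} → Pick U u r → (∏ (λ v → diff v u) r) ⁻¹ ≡ ε * (monomial 0 u * weight u r)
    flip-term {u} {r} p = begin
      (∏ (λ v → diff v u) r) ⁻¹              ≡⟨ cong _⁻¹ (∏-diff-flip u r) ⟩
      (sign (length r) * ∏ (diff u) r) ⁻¹    ≡⟨ ⁻¹-* (sign (length r)) (∏ (diff u) r) ⟩
      (sign (length r)) ⁻¹ * weight u r      ≡⟨ cong (_* weight u r) (sign-⁻¹ (length r)) ⟩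
      sign (length r) * weight u r           ≡⟨ cong (λ i → sign i * weight u r) (sym (ℕP.suc-injective (pick-length p))) ⟩
      ε * weight u r                         ≡⟨ cong (ε *_) (sym (ℚP.*-identityˡ (weight u r))) ⟩
      ε * (monomial 0 u * weight u r) ∎

  partial-fractions : ∀ t R → Unique (t ∷ R) → 1 ℕ.≤ length R →
    ΣPick (λ i R′ → (diff i t) ⁻¹ * (∏ (λ j → diff j i) R′) ⁻¹) R ≡ (∏ (λ j → diff j t) R) ⁻¹
  partial-fractions t (x ∷ V) uniq _ = begin
    Y                                    ≡⟨ solve 2 (λ X Y → Y := X :- (X :+ (:- con 1ℚ) :* Y)) refl X Y ⟩
    X - (X + (- 1ℚ) * Y)                 ≡⟨ cong (λ z → X - (X + z)) (sym (ΣPick-scale (x ∷ V) (- 1ℚ) term)) ⟩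
    X - (X + ΣPick (λ u r → (- 1ℚ) * term u r) (x ∷ V))
      ≡⟨ cong (λ z → X - (X + z)) (ΣPick-cong (x ∷ V) (λ {u} {r} _ → sym (flipped-term u r))) ⟩
    X - ΣPick (λ u r → (∏ (λ v → diff v u) r) ⁻¹) (t ∷ x ∷ V)
      ≡⟨ cong (_-_ X) (ΣPick-flipped-weights-≡0 t x V uniq) ⟩
    X - 0ℚ                               ≡⟨ solve 1 (λ X → X :- con 0ℚ := X) refl X ⟩
    X ∎
    where
    term : ℕ → List ℕ → ℚ
    term i R′ = (diff i t) ⁻¹ * (∏ (λ j → diff j i) R′) ⁻¹
    X Y : ℚ
    Y = ΣPick term (x ∷ V)
    X = (∏ (λ j → diff j t) (x ∷ V)) ⁻¹
    flipped-term : ∀ u r → (∏ (λ v → diff v u) (t ∷ r)) ⁻¹ ≡ (- 1ℚ) * term u r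
    flipped-term u r = begin
      (diff t u * ∏ (λ v → diff v u) r) ⁻¹         ≡⟨ ⁻¹-* (diff t u) _ ⟩
      (diff t u) ⁻¹ * (∏ (λ v → diff v u) r) ⁻¹   ≡⟨ cong (λ z → z ⁻¹ * (∏ (λ v → diff v u) r) ⁻¹)
                                                       (solve 2 (λ a b → b :- a := :- (a :- b)) refl (toℚ u) (toℚ t)) ⟩
      (- diff u t) ⁻¹ * (∏ (λ v → diff v u) r) ⁻¹ ≡⟨ cong (_* (∏ (λ v → diff v u) r) ⁻¹) (⁻¹-neg (diff u t)) ⟩
      (- (diff u t) ⁻¹) * (∏ (λ v → diff v u) r) ⁻¹
        ≡⟨ solve 2 (λ a b → (:- a) :* b := (:- con 1ℚ) :* (a :* b)) refl ((diff u t) ⁻¹) ((∏ (λ v → diff v u) r) ⁻¹) ⟩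
      (- 1ℚ) * term u r ∎

module SubsetSumIdentity where

  open RationalArithmetic
  open ListSums
  open DividedDifferences
  open import Data.Nat as ℕ using (ℕ; zero; suc; _∸_)
  import Data.Nat.Properties as ℕP
  open import Data.List using (List; _∷_; length)
  open import Data.List.Relation.Unary.All using (All; _∷_)
  open import Data.List.Relation.Unary.AllPairs using (_∷_)
  open import Data.List.Relation.Unary.Unique.Propositional using (Unique)
  open import Data.Product using (proj₁; proj₂)
  open import Data.Empty using (⊥-elim)
  open import Relation.Nullary using (yes; no)
  open import Data.Rational as ℚ using (ℚ; 0ℚ; 1ℚ; _+_; _*_; -_; _-_)
  import Data.Rational.Properties as ℚP
  open import Algebra.Definitions.RawSemiring ℚ.+-*-rawSemiring using (_^_)
  open import Relation.Binary.PropositionalEquality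
  open import Data.Rational.Solver using (module +-*-Solver)
  open +-*-Solver
  open ≡-Reasoning

  -- divDiff-poly provides the hypothesis for a polynomial F of degree k + 1 with leading coefficient A.
  module SubsetSum (F : ℕ → ℚ) (A : ℚ) (k : ℕ)
    (divDiff-F : ∀ t S → Unique (t ∷ S) → length S ≡ suc k → divDiff F (t ∷ S) ≡ A) where

    nodal : List ℕ → ℕ → ℚ
    nodal S j = ∏ (λ i → diff j i) S

    summand : List ℕ → List ℕ → ℚ
    summand S R = ∏ (λ j → F j * (nodal S j) ⁻¹) R

    subsetSum : List ℕ → ℚ
    subsetSum T = ΣSplit (suc k) summand T

    summand-∷ : ∀ i S R → summand (i ∷ S) R ≡ summand S R * (∏ (λ j → diff j i) R) ⁻¹
    summand-∷ i S R = begin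
      ∏ (λ j → F j * (diff j i * nodal S j) ⁻¹) R
        ≡⟨ ∏-cong R (λ j → trans (cong (F j *_) (⁻¹-* (diff j i) (nodal S j)))
             (solve 3 (λ f a b → f :* (a :* b) := f :* b :* a) refl (F j) ((diff j i) ⁻¹) ((nodal S j) ⁻¹))) ⟩
      ∏ (λ j → F j * (nodal S j) ⁻¹ * (diff j i) ⁻¹) R
        ≡⟨ ∏-* (λ j → F j * (nodal S j) ⁻¹) (λ j → (diff j i) ⁻¹) R ⟩
      summand S R * ∏ (λ j → (diff j i) ⁻¹) R
        ≡⟨ cong (summand S R *_) (∏-⁻¹ (λ j → diff j i) R) ⟩
      summand S R * (∏ (λ j → diff j i) R) ⁻¹ ∎

    -- The divided difference F[t, S] minus its t-term.
    rest : ℕ → List ℕ → ℚ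
    rest t S = ΣPick (λ u r → F u * weight u (t ∷ r)) S

    summand-extend : ∀ t S R → Unique (t ∷ S) → length S ≡ suc k →
                     summand S (t ∷ R) ≡ A * summand S R - rest t S * summand S R
    summand-extend t S R uniq |S|≡ = begin
      F t * weight t S * summand S R
        ≡⟨ cong (_* summand S R) (solve 2 (λ x q → x := x :+ q :- q) refl (F t * weight t S) (rest t S)) ⟩
      (divDiff F (t ∷ S) - rest t S) * summand S R
        ≡⟨ cong (λ z → (z - rest t S) * summand S R) (divDiff-F t S uniq |S|≡) ⟩
      (A - rest t S) * summand S R
        ≡⟨ solve 3 (λ a q g → (a :- q) :* g := a :* g :- q :* g) refl A (rest t S) (summand S R) ⟩
      A * summand S R - rest t S * summand S R ∎

    -- Expanding rest t S as a sum over i ∈ S and exchanging the order of summation, the inner sums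
    -- collapse by partial fractions.
    Σrest-exchange : ∀ t T → Unique (t ∷ T) → suc k ℕ.≤ length T →
      ΣSplit (suc k) (λ S R → rest t S * summand S R) T ≡ ΣSplit k (λ S R → summand (t ∷ S) R) T
    Σrest-exchange t T (t∉T ∷ uniq) k<|T| = begin
      ΣSplit (suc k) (λ S R → rest t S * summand S R) T
        ≡⟨ ΣSplit-cong (suc k) T expand ⟩
      ΣSplit (suc k) (λ S R → ΣPick (λ i S′ → K S′ i R) S) T
        ≡⟨ ΣSplit-ΣPick-exchange T k K ⟩
      ΣSplit k (λ S′ R′ → ΣPick (λ i R → K S′ i R) R′) T
        ≡⟨ ΣSplit-cong k T collapse ⟩
      ΣSplit k (λ S R → summand (t ∷ S) R) T ∎
      where
      K : List ℕ → ℕ → List ℕ → ℚ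
      K S′ i R = summand (i ∷ S′) R * (F i * weight i (t ∷ S′))

      expand : ∀ {S R} → Split (suc k) T S R → rest t S * summand S R ≡ ΣPick (λ i S′ → K S′ i R) S
      expand {S} {R} _ = begin
        rest t S * summand S R
          ≡⟨ ℚP.*-comm (rest t S) (summand S R) ⟩
        summand S R * rest t S
          ≡⟨ sym (ΣPick-scale S (summand S R) (λ u r → F u * weight u (t ∷ r))) ⟩
        ΣPick (λ u r → summand S R * (F u * weight u (t ∷ r))) S
          ≡⟨ ΣPick-cong S (λ {u} {r} p → cong (_* (F u * weight u (t ∷ r)))
               (∏-cong R (λ j → cong (λ z → F j * z ⁻¹) (∏-pick (λ i → diff j i) p)))) ⟩
        ΣPick (λ i S′ → K S′ i R) S ∎

      collapse : ∀ {S′ R′} → Split k T S′ R′ → ΣPick (λ i R → K S′ i R) R′ ≡ summand (t ∷ S′) R′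
      collapse {S′} {R′} c = begin
        ΣPick (λ i R → K S′ i R) R′
          ≡⟨ ΣPick-cong R′ factor ⟩
        ΣPick (λ i R → summand S′ R′ * ((diff i t) ⁻¹ * (∏ (λ j → diff j i) R) ⁻¹)) R′
          ≡⟨ ΣPick-scale R′ (summand S′ R′) (λ i R → (diff i t) ⁻¹ * (∏ (λ j → diff j i) R) ⁻¹) ⟩
        summand S′ R′ * ΣPick (λ i R → (diff i t) ⁻¹ * (∏ (λ j → diff j i) R) ⁻¹) R′
          ≡⟨ cong (summand S′ R′ *_) (partial-fractions t R′ (t∉R′ ∷ proj₁ (proj₂ (split-unique uniq c))) R′-nonempty) ⟩
        summand S′ R′ * (∏ (λ j → diff j t) R′) ⁻¹
          ≡⟨ sym (summand-∷ t S′ R′) ⟩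
        summand (t ∷ S′) R′ ∎
        where
        t∉R′ : All (t ≢_) R′
        t∉R′ = proj₂ (split-All t∉T c)
        R′-nonempty : 1 ℕ.≤ length R′
        R′-nonempty with length R′ | split-length-rest c
        ... | zero  | |T|≡k+0 = ⊥-elim (ℕP.<⇒≱ k<|T| (ℕP.≤-reflexive (trans |T|≡k+0 (ℕP.+-identityʳ k))))
        ... | suc _ | _ = ℕ.s≤s ℕ.z≤n
        factor : ∀ {i R} → Pick R′ i R →
                 K S′ i R ≡ summand S′ R′ * ((diff i t) ⁻¹ * (∏ (λ j → diff j i) R) ⁻¹)
        factor {i} {R} p = begin
          summand (i ∷ S′) R * (F i * weight i (t ∷ S′))
            ≡⟨ cong₂ (λ a b → a * (F i * b)) (summand-∷ i S′ R) (weight-∷ i t S′) ⟩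
          summand S′ R * Iᵢ * (F i * (Iₜ * weight i S′))
            ≡⟨ solve 5 (λ g I f J w → g :* I :* (f :* (J :* w)) := (f :* w :* g) :* (J :* I)) refl
                 (summand S′ R) Iᵢ (F i) Iₜ (weight i S′) ⟩
          (F i * weight i S′ * summand S′ R) * (Iₜ * Iᵢ)
            ≡⟨ cong (_* (Iₜ * Iᵢ)) (sym (∏-pick (λ j → F j * (nodal S′ j) ⁻¹) p)) ⟩
          summand S′ R′ * (Iₜ * Iᵢ) ∎
          where
          Iᵢ Iₜ : ℚ
          Iᵢ = (∏ (λ j → diff j i) R) ⁻¹
          Iₜ = (diff i t) ⁻¹

    -- Sorting the subsets by whether they contain t gives subsetSum (t ∷ T) = A · subsetSum T.
    subsetSum-closedForm : ∀ T → Unique T → suc k ℕ.≤ length T → subsetSum T ≡ A ^ (length T ∸ suc k)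
    subsetSum-closedForm (t ∷ T) (t∉T ∷ uniq) k<|tT| with suc k ℕ.≤? length T
    ... | no k≮|T| = begin
        ΣSplit (suc k) (λ S R → summand S (t ∷ R)) T + ΣSplit k (λ S R → summand (t ∷ S) R) T
          ≡⟨ cong₂ _+_ (ΣSplit-short (suc k) T _ (subst (ℕ._< suc k) (sym |T|≡k) (ℕP.n<1+n k)))
                       (subst (λ i → ΣSplit i (λ S R → summand (t ∷ S) R) T ≡ 1ℚ) |T|≡k (ΣSplit-all T _)) ⟩
        0ℚ + 1ℚ
          ≡⟨ cong (A ^_) (sym (trans (cong (length T ∸_) (sym |T|≡k)) (ℕP.n∸n≡0 (length T)))) ⟩
        A ^ (length T ∸ k) ∎
      where
      |T|≡k : length T ≡ k
      |T|≡k = ℕP.≤-antisym (ℕP.≤-pred (ℕP.≰⇒> k≮|T|)) (ℕP.≤-pred k<|tT|)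
    ... | yes k<|T| = begin
        ΣSplit (suc k) (λ S R → summand S (t ∷ R)) T + B
          ≡⟨ cong (_+ B) (ΣSplit-cong (suc k) T extend) ⟩
        ΣSplit (suc k) (λ S R → A * summand S R - rest t S * summand S R) T + B
          ≡⟨ cong (_+ B) (ΣSplit-- (suc k) T (λ S R → A * summand S R) (λ S R → rest t S * summand S R)) ⟩
        ΣSplit (suc k) (λ S R → A * summand S R) T - ΣSplit (suc k) (λ S R → rest t S * summand S R) T + B
          ≡⟨ cong₂ (λ a b → a - b + B) (ΣSplit-scale (suc k) T A summand) (Σrest-exchange t T (t∉T ∷ uniq) k<|T|) ⟩
        A * subsetSum T - B + B
          ≡⟨ solve 2 (λ x b → x :- b :+ b := x) refl (A * subsetSum T) B ⟩
        A * subsetSum T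
          ≡⟨ cong (A *_) (subsetSum-closedForm T uniq k<|T|) ⟩
        A ^ suc (length T ∸ suc k)
          ≡⟨ cong (A ^_) (sym (ℕP.+-∸-assoc 1 k<|T|)) ⟩
        A ^ (length T ∸ k) ∎
      where
      B : ℚ
      B = ΣSplit k (λ S R → summand (t ∷ S) R) T
      extend : ∀ {S R} → Split (suc k) T S R → summand S (t ∷ R) ≡ A * summand S R - rest t S * summand S R
      extend {S} {R} c = summand-extend t S R (proj₁ (split-All t∉T c) ∷ proj₁ (split-unique uniq c)) (split-length c)

module Intervals where

  open ListSums using (Pick; here; there; Split; done; skip; take)
  open import Data.Nat using (ℕ; zero; suc; _+_; _*_; _∸_; _≤_; _^_; _!)
  import Data.Nat.Properties as ℕP
  open import Data.Nat.Divisibility using (_∣_; m∣m*n; *-pres-∣; ∣-refl)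
  open import Data.Nat.Combinatorics.Specification using ([n∸k]!k!∣n!)
  open import Data.Nat.ListAction using (product)
  open import Data.Integer as ℤ using (+_)
  import Data.Integer.Properties as ℤP
  open import Data.List using (List; []; _∷_; length; _++_; map; applyUpTo)
  open import Data.List.Relation.Unary.All using (All; []; _∷_)
  open import Data.List.Relation.Unary.AllPairs using ([]; _∷_)
  open import Data.List.Relation.Unary.Unique.Propositional using (Unique)
  open import Data.Product using (_×_; _,_; Σ)
  open import Relation.Binary.PropositionalEquality
  open import Data.Nat.Solver using (module +-*-Solver)
  open +-*-Solver
  open ≡-Reasoning

  ∏ℕ : (ℕ → ℕ) → List ℕ → ℕ
  ∏ℕ g xs = product (map g xs)

  ∏ℕ-++ : ∀ g xs ys → ∏ℕ g (xs ++ ys) ≡ ∏ℕ g xs * ∏ℕ g ys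
  ∏ℕ-++ g [] ys = sym (ℕP.+-identityʳ _)
  ∏ℕ-++ g (x ∷ xs) ys = trans (cong (g x *_) (∏ℕ-++ g xs ys)) (sym (ℕP.*-assoc (g x) _ _))

  ∏ℕ-* : ∀ (a b : ℕ → ℕ) R → ∏ℕ (λ j → a j * b j) R ≡ ∏ℕ a R * ∏ℕ b R
  ∏ℕ-* a b [] = refl
  ∏ℕ-* a b (x ∷ R) = trans (cong (a x * b x *_) (∏ℕ-* a b R))
    (solve 4 (λ p q r t → p :* q :* (r :* t) := p :* r :* (q :* t)) refl (a x) (b x) (∏ℕ a R) (∏ℕ b R))

  ∏ℕ-1 : ∀ S → ∏ℕ (λ _ → 1) S ≡ 1
  ∏ℕ-1 [] = refl
  ∏ℕ-1 (x ∷ S) = trans (ℕP.+-identityʳ _) (∏ℕ-1 S)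

  ∏ℕ-swap : ∀ (h : ℕ → ℕ → ℕ) R S → ∏ℕ (λ j → ∏ℕ (λ i → h j i) S) R ≡ ∏ℕ (λ i → ∏ℕ (λ j → h j i) R) S
  ∏ℕ-swap h [] S = sym (∏ℕ-1 S)
  ∏ℕ-swap h (x ∷ R) S = trans (cong (∏ℕ (λ i → h x i) S *_) (∏ℕ-swap h R S))
    (sym (∏ℕ-* (λ i → h x i) (λ i → ∏ℕ (λ j → h j i) R) S))

  ∏ℕ-split : ∀ {k T S R} (g : ℕ → ℕ) → Split k T S R → ∏ℕ g T ≡ ∏ℕ g S * ∏ℕ g R
  ∏ℕ-split g done = sym (ℕP.+-identityʳ _)
  ∏ℕ-split {T = x ∷ T} {S} {x ∷ R} g (skip c) = trans (cong (g x *_) (∏ℕ-split g c))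
    (solve 3 (λ a b c → a :* (b :* c) := b :* (a :* c)) refl (g x) (∏ℕ g S) (∏ℕ g R))
  ∏ℕ-split {T = x ∷ T} {x ∷ S} {R} g (take c) = trans (cong (g x *_) (∏ℕ-split g c)) (sym (ℕP.*-assoc (g x) (∏ℕ g S) (∏ℕ g R)))

  ∏ℕ-rest-∣ : ∀ {k T S R} (g : ℕ → ℕ) → Split k T S R → ∏ℕ g R ∣ ∏ℕ g T
  ∏ℕ-rest-∣ {S = S} {R} g c =
    subst (∏ℕ g R ∣_) (sym (trans (∏ℕ-split g c) (ℕP.*-comm (∏ℕ g S) (∏ℕ g R)))) (m∣m*n (∏ℕ g S))

  ∏ℕ-∣-^ : ∀ S (h : ℕ → ℕ) d → (∀ {i S′} → Pick S i S′ → h i ∣ d) → ∏ℕ h S ∣ d ^ length S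
  ∏ℕ-∣-^ [] h d _ = ∣-refl
  ∏ℕ-∣-^ (x ∷ S) h d h∣d = *-pres-∣ (h∣d here) (∏ℕ-∣-^ S h d (λ p → h∣d (there p)))

  split-∷ʳ : ∀ {k T S R x} → Split k T S R → Split k (x ∷ T) S (x ∷ R)
  split-∷ʳ done = done
  split-∷ʳ (skip c) = skip (skip c)
  split-∷ʳ (take c) = skip (take c)

  split-pick : ∀ {k T S R i S′} → Split (suc k) T S R → Pick S i S′ →
               Σ (List ℕ) (λ T′ → Pick T i T′ × Split k T′ S′ R)
  split-pick (skip c) p with split-pick c p
  ... | (T′ , q , c′) = _ , there q , split-∷ʳ c′
  split-pick (take c) here = _ , here , c
  split-pick {zero} (take done) (there ())
  split-pick {suc k} (take c) (there p) with split-pick c p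
  ... | (T′ , q , c′) = _ , there q , take c′

  interval : ℕ → ℕ → List ℕ
  interval b zero = []
  interval b (suc c) = b ∷ interval (suc b) c

  interval-length : ∀ b c → length (interval b c) ≡ c
  interval-length b zero = refl
  interval-length b (suc c) = cong suc (interval-length (suc b) c)

  applyUpTo-interval : ∀ c (f : ℕ → ℕ) b → (∀ i → f i ≡ b + i) → applyUpTo f c ≡ interval b c
  applyUpTo-interval zero f b _ = refl
  applyUpTo-interval (suc c) f b f≗b+ = cong₂ _∷_ (trans (f≗b+ 0) (ℕP.+-identityʳ b))
    (applyUpTo-interval c (λ i → f (suc i)) (suc b) (λ i → trans (f≗b+ (suc i)) (ℕP.+-suc b i)))

  interval-≥ : ∀ b c {d} → d ≤ b → All (d ≤_) (interval b c)
  interval-≥ b zero _ = []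
  interval-≥ b (suc c) d≤b = d≤b ∷ interval-≥ (suc b) c (ℕP.m≤n⇒m≤1+n d≤b)

  interval-unique : ∀ b c → Unique (interval b c)
  interval-unique b zero = []
  interval-unique b (suc c) = b∉ (interval-≥ (suc b) c ℕP.≤-refl) ∷ interval-unique (suc b) c
    where
    b∉ : ∀ {xs} → All (suc b ≤_) xs → All (b ≢_) xs
    b∉ [] = []
    b∉ (b<x ∷ b<xs) = (λ b≡x → ℕP.<-irrefl b≡x b<x) ∷ b∉ b<xs

  interval-suc : ∀ b c → interval b (suc c) ≡ interval b c ++ (b + c ∷ [])
  interval-suc b zero = cong (_∷ []) (sym (ℕP.+-identityʳ b))
  interval-suc b (suc c) = cong (b ∷_)
    (trans (interval-suc (suc b) c) (cong (λ z → interval (suc b) c ++ (z ∷ [])) (sym (ℕP.+-suc b c))))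

  dist : ℕ → ℕ → ℕ
  dist j i = ℤ.∣ + j ℤ.- + i ∣

  dist-≥ : ∀ {i j} → i ≤ j → dist j i ≡ j ∸ i
  dist-≥ {i} {j} i≤j = cong ℤ.∣_∣ (trans (ℤP.m-n≡m⊖n j i) (ℤP.⊖-≥ i≤j))

  dist-≤ : ∀ {i j} → j ≤ i → dist j i ≡ i ∸ j
  dist-≤ {i} {j} j≤i = trans (cong ℤ.∣_∣ (ℤP.m-n≡m⊖n j i)) (ℤP.∣⊖∣-≤ j≤i)

  ∏-dist-interval : ∀ b c → ∏ℕ (λ j → dist j b) (interval (suc b) c) ≡ c !
  ∏-dist-interval b zero = refl
  ∏-dist-interval b (suc c) = begin
    ∏ℕ (λ j → dist j b) (interval (suc b) (suc c))
      ≡⟨ cong (∏ℕ (λ j → dist j b)) (interval-suc (suc b) c) ⟩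
    ∏ℕ (λ j → dist j b) (interval (suc b) c ++ (suc b + c ∷ []))
      ≡⟨ ∏ℕ-++ _ (interval (suc b) c) _ ⟩
    ∏ℕ (λ j → dist j b) (interval (suc b) c) * (dist (suc b + c) b * 1)
      ≡⟨ cong₂ (λ x y → x * (y * 1)) (∏-dist-interval b c) dist≡ ⟩
    c ! * (suc c * 1)
      ≡⟨ solve 2 (λ f c → f :* ((con 1 :+ c) :* con 1) := (con 1 :+ c) :* f) refl (c !) c ⟩
    suc c ! ∎
    where
    dist≡ : dist (suc b + c) b ≡ suc c
    dist≡ = trans (dist-≥ (ℕP.≤-trans (ℕP.n≤1+n b) (ℕP.m≤m+n (suc b) c)))
      (trans (cong (_∸ b) (sym (ℕP.+-suc b c))) (ℕP.m+n∸m≡n b (suc c)))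

  ∏-dist-pick : ∀ c b {i T} → Pick (interval b (suc c)) i T →
    b ≤ i × i ≤ b + c × ∏ℕ (λ j → dist j i) T ≡ (i ∸ b) ! * (b + c ∸ i) !
  ∏-dist-pick c b here = ℕP.≤-refl , ℕP.m≤m+n b c ,
    trans (∏-dist-interval b c) (trans (sym (ℕP.+-identityʳ (c !)))
      (cong₂ (λ x y → x ! * y !) (sym (ℕP.n∸n≡0 b)) (sym (ℕP.m+n∸m≡n b c))))
  ∏-dist-pick (suc c) b {i} {b ∷ T} (there p) with ∏-dist-pick c (suc b) p
  ... | (b<i , i≤b+c , eq) = ℕP.≤-trans (ℕP.n≤1+n b) b<i , ℕP.≤-trans i≤b+c (ℕP.≤-reflexive (sym (ℕP.+-suc b c))) , (begin
    dist b i * ∏ℕ (λ j → dist j i) T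
      ≡⟨ cong₂ _*_ (dist-≤ (ℕP.≤-trans (ℕP.n≤1+n b) b<i)) eq ⟩
    (i ∸ b) * ((i ∸ suc b) ! * (suc b + c ∸ i) !)
      ≡⟨ cong (λ z → z * ((i ∸ suc b) ! * (suc b + c ∸ i) !)) (sym i∸b≡) ⟩
    suc (i ∸ suc b) * ((i ∸ suc b) ! * (suc b + c ∸ i) !)
      ≡⟨ sym (ℕP.*-assoc (suc (i ∸ suc b)) ((i ∸ suc b) !) ((suc b + c ∸ i) !)) ⟩
    suc (i ∸ suc b) ! * (suc b + c ∸ i) !
      ≡⟨ cong₂ (λ x y → x ! * y !) i∸b≡ (sym (cong (_∸ i) (ℕP.+-suc b c))) ⟩
    (i ∸ b) ! * (b + suc c ∸ i) ! ∎)
    where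
    i∸b≡ : suc (i ∸ suc b) ≡ i ∸ b
    i∸b≡ = sym (ℕP.+-∸-assoc 1 b<i)

  -- (i − b)! (b + c − i)! divides c!, the quotient being a binomial coefficient.
  ∏-dist-pick-∣ : ∀ c b {i T} → Pick (interval b (suc c)) i T → ∏ℕ (λ j → dist j i) T ∣ c !
  ∏-dist-pick-∣ c b {i} p with ∏-dist-pick c b p
  ... | (b≤i , i≤b+c , eq) = subst (_∣ c !) (sym (trans eq swap)) ([n∸k]!k!∣n! {c} {i ∸ b} i∸b≤c)
    where
    i∸b≤c : i ∸ b ≤ c
    i∸b≤c = subst (i ∸ b ≤_) (ℕP.m+n∸m≡n b c) (ℕP.∸-monoˡ-≤ b i≤b+c)
    swap : (i ∸ b) ! * (b + c ∸ i) ! ≡ (c ∸ (i ∸ b)) ! * (i ∸ b) !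
    swap = trans (cong (λ z → (i ∸ b) ! * z !)
        (trans (cong (b + c ∸_) (sym (ℕP.m+[n∸m]≡n b≤i))) (ℕP.[m+n]∸[m+o]≡n∸o b c (i ∸ b))))
      (ℕP.*-comm ((i ∸ b) !) ((c ∸ (i ∸ b)) !))

module ProductBound where

  open import Defs
  open RationalArithmetic
  open ListSums
  open DividedDifferences
  open SubsetSumIdentity
  open Intervals
  open import Data.Nat as ℕ using (ℕ; zero; suc; _∸_; _!; z≤n)
  import Data.Nat.Properties as ℕP
  open import Algebra.Properties.CommutativeSemigroup ℕP.*-commutativeSemigroup using (interchange)
  open import Data.Nat.Divisibility as ℕ∣ using (∣-trans)
  open import Data.Nat.LCM using (m∣lcm[m,n]; n∣lcm[m,n]; gcd*lcm)
  open import Data.Nat.GCD using (gcd)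
  open import Data.Integer as ℤ using (ℤ; +_; 0ℤ)
  import Data.Integer.Properties as ℤP
  import Data.Integer.Divisibility.Signed as ℤ∣
  open import Data.List as List using (List; []; _∷_; length)
  open import Data.List.Relation.Unary.All as All using (All; []; _∷_)
  open import Data.List.Relation.Unary.Unique.Propositional using (Unique)
  open import Data.Vec as Vec using (Vec; lookup) renaming ([] to []ᵥ; _∷_ to _∷ᵥ_)
  open import Data.Vec.Properties using (lookup-map)
  open import Data.Fin using (fromℕ)
  open import Data.Product using (_,_; proj₁; proj₂; Σ)
  open import Data.Sum using (inj₁; inj₂)
  open import Function using (_∘_)
  open import Relation.Nullary using (¬_; Dec; yes; no)
  open import Data.Rational as ℚ using (ℚ; 0ℚ; 1ℚ; _+_; _*_; -_; _-_)
  import Data.Rational.Properties as ℚP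
  open import Algebra.Definitions.RawSemiring ℚ.+-*-rawSemiring using (_^_)
  open import Relation.Binary.PropositionalEquality
  open import Data.Rational.Solver using (module +-*-Solver)
  open +-*-Solver

  ∏ℤ : (ℕ → ℤ) → List ℕ → ℤ
  ∏ℤ g [] = + 1
  ∏ℤ g (x ∷ xs) = g x ℤ.* ∏ℤ g xs

  fromℤ-∏ : ∀ (h : ℕ → ℤ) X → fromℤ (∏ℤ h X) ≡ ∏ (fromℤ ∘ h) X
  fromℤ-∏ h [] = refl
  fromℤ-∏ h (x ∷ X) = trans (fromℤ-* (h x) (∏ℤ h X)) (cong (fromℤ (h x) *_) (fromℤ-∏ h X))

  ∣∏ℤ∣ : ∀ (h : ℕ → ℤ) X → ℤ.∣ ∏ℤ h X ∣ ≡ ∏ℕ (ℤ.∣_∣ ∘ h) X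
  ∣∏ℤ∣ h [] = refl
  ∣∏ℤ∣ h (x ∷ X) = trans (ℤP.abs-* (h x) (∏ℤ h X)) (cong (ℤ.∣ h x ∣ ℕ.*_) (∣∏ℤ∣ h X))

  fromℤ-^ : ∀ z e → fromℤ (z ℤ.^ e) ≡ fromℤ z ^ e
  fromℤ-^ z zero = refl
  fromℤ-^ z (suc e) = trans (fromℤ-* z (z ℤ.^ e)) (cong (fromℤ z *_) (fromℤ-^ z e))

  ∣^∣ : ∀ z e → ℤ.∣ z ℤ.^ e ∣ ≡ ℤ.∣ z ∣ ℕ.^ e
  ∣^∣ z zero = refl
  ∣^∣ z (suc e) = trans (ℤP.abs-* z (z ℤ.^ e)) (cong (ℤ.∣ z ∣ ℕ.*_) (∣^∣ z e))

  *-distrib-^ : ∀ x y e → (x ℕ.* y) ℕ.^ e ≡ x ℕ.^ e ℕ.* y ℕ.^ e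
  *-distrib-^ x y zero = refl
  *-distrib-^ x y (suc e) = trans (cong ((x ℕ.* y) ℕ.*_) (*-distrib-^ x y e)) (interchange x y (x ℕ.^ e) (y ℕ.^ e))

  fromℤ-horner : ∀ {n} (a : Vec ℤ n) x →
    fromℤ (Vec.foldr (λ _ → ℤ) (λ c acc → c ℤ.+ x ℤ.* acc) (+ 0) a) ≡ evalℚ (Vec.map fromℤ a) (fromℤ x)
  fromℤ-horner []ᵥ x = refl
  fromℤ-horner (c ∷ᵥ cs) x = trans (fromℤ-+ c _)
    (cong (_+_ (fromℤ c)) (trans (fromℤ-* x _) (cong (fromℤ x *_) (fromℤ-horner cs x))))

  ∏ℕ-cong : ∀ {a b : ℕ → ℕ} R → (∀ j → a j ≡ b j) → ∏ℕ a R ≡ ∏ℕ b R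
  ∏ℕ-cong [] h = refl
  ∏ℕ-cong (x ∷ R) h = cong₂ ℕ._*_ (h x) (∏ℕ-cong R h)

  ∏ℕ-≢0 : ∀ (f : ℕ → ℕ) xs → ∏ℕ f xs ≢ 0 → All (λ j → f j ≢ 0) xs
  ∏ℕ-≢0 f [] _ = []
  ∏ℕ-≢0 f (x ∷ xs) ∏≢0 =
    (λ fx≡0 → ∏≢0 (cong (ℕ._* ∏ℕ f xs) fx≡0)) ∷ ∏ℕ-≢0 f xs (λ ∏≡0 → ∏≢0 (trans (cong (f x ℕ.*_) ∏≡0) (ℕP.*-zeroʳ (f x))))

  ∏ℕ-≤-^ : ∀ (f : ℕ → ℕ) xs b → All (λ j → f j ℕ.≤ b) xs → ∏ℕ f xs ℕ.≤ b ℕ.^ length xs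
  ∏ℕ-≤-^ f [] b [] = ℕP.≤-refl
  ∏ℕ-≤-^ f (x ∷ xs) b (fx≤b ∷ fxs≤b) = ℕP.*-mono-≤ fx≤b (∏ℕ-≤-^ f xs b fxs≤b)

  ∣-lcmList : ∀ (f : ℕ → ℕ) xs → All (λ j → f j ℕ∣.∣ lcmList (List.map f xs)) xs
  ∣-lcmList f [] = []
  ∣-lcmList f (x ∷ xs) = m∣lcm[m,n] (f x) _ ∷ All.map (λ d → ∣-trans d (n∣lcm[m,n] (f x) _)) (∣-lcmList f xs)

  lcmList-≢0 : ∀ (f : ℕ → ℕ) xs → All (λ j → f j ≢ 0) xs → lcmList (List.map f xs) ≢ 0
  lcmList-≢0 f [] [] = λ ()
  lcmList-≢0 f (x ∷ xs) (fx≢0 ∷ fxs≢0) lcm≡0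
    with ℕP.m*n≡0⇒m≡0∨n≡0 (f x) (trans (sym (gcd*lcm (f x) l)) (trans (cong (gcd (f x) l ℕ.*_) lcm≡0) (ℕP.*-zeroʳ (gcd (f x) l))))
    where l = lcmList (List.map f xs)
  ... | inj₁ fx≡0 = fx≢0 fx≡0
  ... | inj₂ l≡0 = lcmList-≢0 f xs fxs≢0 l≡0

  ΣSplit-integral : ∀ k T (G : List ℕ → List ℕ → ℚ) (c P : ℚ) →
    (∀ {S R} → Split k T S R → Σ ℤ (λ z → c * G S R ≡ P * fromℤ z)) → Σ ℤ (λ Z → c * ΣSplit k G T ≡ P * fromℤ Z)
  ΣSplit-integral zero T G c P h = h done
  ΣSplit-integral (suc k) [] G c P h = + 0 , trans (ℚP.*-zeroʳ c) (sym (ℚP.*-zeroʳ P))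
  ΣSplit-integral (suc k) (x ∷ T) G c P h
    with ΣSplit-integral (suc k) T (λ S R → G S (x ∷ R)) c P (λ c′ → h (skip c′))
       | ΣSplit-integral k T (λ S R → G (x ∷ S) R) c P (λ c′ → h (take c′))
  ... | (z₁ , e₁) | (z₂ , e₂) = z₁ ℤ.+ z₂ , (begin
    c * (a + b)                   ≡⟨ ℚP.*-distribˡ-+ c a b ⟩
    c * a + c * b                 ≡⟨ cong₂ _+_ e₁ e₂ ⟩
    P * fromℤ z₁ + P * fromℤ z₂   ≡⟨ sym (ℚP.*-distribˡ-+ P (fromℤ z₁) (fromℤ z₂)) ⟩
    P * (fromℤ z₁ + fromℤ z₂)     ≡⟨ cong (P *_) (sym (fromℤ-+ z₁ z₂)) ⟩
    P * fromℤ (z₁ ℤ.+ z₂) ∎)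
    where
    open ≡-Reasoning
    a b : ℚ
    a = ΣSplit (suc k) (λ S R → G S (x ∷ R)) T
    b = ΣSplit k (λ S R → G (x ∷ S) R) T

  module LcmBound (k : ℕ) (a : Poly (suc k)) (aₛ≢0 : lookup a (fromℕ (suc k)) ≢ 0ℤ) (m n : ℕ) where

    s N : ℕ
    s = suc k
    N = suc (n ∸ m)

    T : List ℕ
    T = interval m N

    f : ℕ → ℤ
    f j = eval a (+ j)

    L Δ : ℕ
    L = lcmVals a m n
    Δ = (n ∸ m) !

    aₛ : ℤ
    aₛ = lookup a (fromℕ s)

    range≡T : range m n ≡ T
    range≡T = applyUpTo-interval N (m ℕ.+_) m (λ _ → refl)

    f∣L : All (λ j → ℤ.∣ f j ∣ ℕ∣.∣ L) T
    f∣L = subst (All (λ j → ℤ.∣ f j ∣ ℕ∣.∣ L)) range≡T (∣-lcmList (ℤ.∣_∣ ∘ f) (range m n))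

    divDiff-f : ∀ t S → Unique (t ∷ S) → length S ≡ suc k → divDiff (fromℤ ∘ f) (t ∷ S) ≡ fromℤ aₛ
    divDiff-f t S uniq |S|≡ = begin
      divDiff (fromℤ ∘ f) (t ∷ S)
        ≡⟨ ΣPick-cong (t ∷ S) (λ {u} {r} _ → cong (_* weight u r)
             (trans (fromℤ-horner a (+ u)) (sym (ℚP.*-identityˡ _)))) ⟩
      divDiff (λ u → monomial 0 u * evalℚ (Vec.map fromℤ a) (toℚ u)) (t ∷ S)
        ≡⟨ divDiff-poly s (Vec.map fromℤ a) 0 (t ∷ S) uniq (cong suc |S|≡) ⟩
      lookup (Vec.map fromℤ a) (fromℕ s)
        ≡⟨ lookup-map (fromℕ s) fromℤ a ⟩
      fromℤ aₛ ∎
      where open ≡-Reasoning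

    open SubsetSum (fromℤ ∘ f) (fromℤ aₛ) k divDiff-f

    nodalℤ : List ℕ → ℕ → ℤ
    nodalℤ S j = ∏ℤ (λ i → + j ℤ.- + i) S

    fromℤ-nodalℤ : ∀ S j → fromℤ (nodalℤ S j) ≡ nodal S j
    fromℤ-nodalℤ S j = trans (fromℤ-∏ (λ i → + j ℤ.- + i) S)
      (∏-cong S (λ i → trans (fromℤ-+ (+ j) (ℤ.- (+ i))) (cong (_+_ (toℚ j)) (fromℤ-neg (+ i)))))

    ∏f-∣ : ∀ {S R} → Split s T S R → ℤ.∣ ∏ℤ f S ∣ ℕ∣.∣ L ℕ.^ s
    ∏f-∣ {S} c = subst₂ ℕ∣._∣_ (sym (∣∏ℤ∣ f S)) (cong (L ℕ.^_) (split-length c))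
      (∏ℕ-∣-^ S (ℤ.∣_∣ ∘ f) L (λ p → proj₁ (pick-All (proj₁ (split-All f∣L c)) p)))

    -- Each i ∈ S ⊆ T contributes ∏_{j ∈ R} |j − i|, a divisor of ∏_{j ∈ T∖{i}} |j − i| ∣ Δ.
    ∏nodal-∣ : ∀ {S R} → Split s T S R → ℤ.∣ ∏ℤ (nodalℤ S) R ∣ ℕ∣.∣ Δ ℕ.^ s
    ∏nodal-∣ {S} {R} c = subst₂ ℕ∣._∣_ ∏≡ (cong (Δ ℕ.^_) (split-length c))
      (∏ℕ-∣-^ S (λ i → ∏ℕ (λ j → dist j i) R) Δ dist∣Δ)
      where
      dist∣Δ : ∀ {i S′} → Pick S i S′ → ∏ℕ (λ j → dist j i) R ℕ∣.∣ Δ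
      dist∣Δ {i} p with split-pick c p
      ... | (T′ , q , c′) = ∣-trans (∏ℕ-rest-∣ (λ j → dist j i) c′) (∏-dist-pick-∣ (n ∸ m) m q)
      ∏≡ : ∏ℕ (λ i → ∏ℕ (λ j → dist j i) R) S ≡ ℤ.∣ ∏ℤ (nodalℤ S) R ∣
      ∏≡ = sym (trans (∣∏ℤ∣ (nodalℤ S) R)
        (trans (∏ℕ-cong R (λ j → ∣∏ℤ∣ (λ i → + j ℤ.- + i) S)) (∏ℕ-swap dist R S)))

    scale : ℚ
    scale = fromℤ (+ ((L ℕ.* Δ) ℕ.^ s))

    summand-integral : ∀ {S R} → Split s T S R → Σ ℤ (λ z → scale * summand S R ≡ ∏ (fromℤ ∘ f) T * fromℤ z)
    summand-integral {S} {R} c with ℤ∣.∣ᵤ⇒∣ {∏ℤ f S} {+ (L ℕ.^ s)} (∏f-∣ c) | ℤ∣.∣ᵤ⇒∣ {∏ℤ (nodalℤ S) R} {+ (Δ ℕ.^ s)} (∏nodal-∣ c)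
    ... | ℤ∣.divides q₁ Lˢ≡ | ℤ∣.divides q₂ Δˢ≡ = q₁ ℤ.* q₂ , (begin
      scale * summand S R
        ≡⟨ cong₂ _*_ (trans scale≡ (cong₂ _*_ Lˢ≡′ Δˢ≡′)) summand≡ ⟩
      (fromℤ q₁ * ∏F S) * (fromℤ q₂ * W) * (∏F R * W ⁻¹)
        ≡⟨ solve 6 (λ a b c d e f → (a :* b) :* (c :* d) :* (e :* f) := (b :* e) :* (a :* c) :* (d :* f)) refl
             (fromℤ q₁) (∏F S) (fromℤ q₂) W (∏F R) (W ⁻¹) ⟩
      (∏F S * ∏F R) * (fromℤ q₁ * fromℤ q₂) * (W * W ⁻¹)
        ≡⟨ cong₂ (λ x y → x * y * (W * W ⁻¹)) (sym (∏-split (fromℤ ∘ f) c)) (sym (fromℤ-* q₁ q₂)) ⟩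
      ∏F T * fromℤ (q₁ ℤ.* q₂) * (W * W ⁻¹)
        ≡⟨ cong (∏F T * fromℤ (q₁ ℤ.* q₂) *_) (⁻¹-inverseʳ W W≢0) ⟩
      ∏F T * fromℤ (q₁ ℤ.* q₂) * 1ℚ
        ≡⟨ ℚP.*-identityʳ _ ⟩
      ∏F T * fromℤ (q₁ ℤ.* q₂) ∎)
      where
      open ≡-Reasoning
      ∏F : List ℕ → ℚ
      ∏F = ∏ (fromℤ ∘ f)
      W : ℚ
      W = ∏ (nodal S) R
      scale≡ : scale ≡ fromℤ (+ (L ℕ.^ s)) * fromℤ (+ (Δ ℕ.^ s))
      scale≡ = trans (cong (λ z → fromℤ (+ z)) (*-distrib-^ L Δ s))
        (trans (cong fromℤ (ℤP.pos-* (L ℕ.^ s) (Δ ℕ.^ s))) (fromℤ-* (+ (L ℕ.^ s)) (+ (Δ ℕ.^ s))))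
      Lˢ≡′ : fromℤ (+ (L ℕ.^ s)) ≡ fromℤ q₁ * ∏F S
      Lˢ≡′ = trans (cong fromℤ Lˢ≡) (trans (fromℤ-* q₁ (∏ℤ f S)) (cong (fromℤ q₁ *_) (fromℤ-∏ f S)))
      Δˢ≡′ : fromℤ (+ (Δ ℕ.^ s)) ≡ fromℤ q₂ * W
      Δˢ≡′ = trans (cong fromℤ Δˢ≡) (trans (fromℤ-* q₂ (∏ℤ (nodalℤ S) R))
        (cong (fromℤ q₂ *_) (trans (fromℤ-∏ (nodalℤ S) R) (∏-cong R (fromℤ-nodalℤ S)))))
      summand≡ : summand S R ≡ ∏F R * W ⁻¹
      summand≡ = trans (∏-* (fromℤ ∘ f) (λ j → (nodal S j) ⁻¹) R) (cong (∏F R *_) (∏-⁻¹ (nodal S) R))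
      W≢0 : W ≢ 0ℚ
      W≢0 = ∏-≢0 (nodal S) R (All.map (λ {j} j∉S → ∏-≢0 (λ i → diff j i) S (All.map diff-≢0 j∉S))
        (proj₂ (proj₂ (split-unique (interval-unique m N) c))))

    ∣f∣ : ℕ → ℕ
    ∣f∣ j = ℤ.∣ f j ∣

    ∣aₛ∣≢0 : ℕ.NonZero ℤ.∣ aₛ ∣
    ∣aₛ∣≢0 = ℕ.≢-nonZero (λ ∣aₛ∣≡0 → aₛ≢0 (ℤP.∣i∣≡0⇒i≡0 ∣aₛ∣≡0))

    cleared-identity : s ℕ.≤ N → Σ ℤ (λ Z → + ((L ℕ.* Δ) ℕ.^ s) ℤ.* aₛ ℤ.^ (N ∸ s) ≡ ∏ℤ f T ℤ.* Z)
    cleared-identity s≤N = Z , fromℤ-injective (begin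
      fromℤ (+ ((L ℕ.* Δ) ℕ.^ s) ℤ.* aₛ ℤ.^ (N ∸ s)) ≡⟨ fromℤ-* (+ ((L ℕ.* Δ) ℕ.^ s)) (aₛ ℤ.^ (N ∸ s)) ⟩
      scale * fromℤ (aₛ ℤ.^ (N ∸ s))                  ≡⟨ cong (scale *_) (fromℤ-^ aₛ (N ∸ s)) ⟩
      scale * fromℤ aₛ ^ (N ∸ s)                      ≡⟨ cong (λ i → scale * fromℤ aₛ ^ (i ∸ s)) (sym |T|≡N) ⟩
      scale * fromℤ aₛ ^ (length T ∸ s)               ≡⟨ cong (scale *_) (sym (subsetSum-closedForm T (interval-unique m N) s≤|T|)) ⟩
      scale * subsetSum T                             ≡⟨ scale*subsetSum≡ ⟩
      ∏ (fromℤ ∘ f) T * fromℤ Z                       ≡⟨ cong (_* fromℤ Z) (sym (fromℤ-∏ f T)) ⟩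
      fromℤ (∏ℤ f T) * fromℤ Z                        ≡⟨ sym (fromℤ-* (∏ℤ f T) Z) ⟩
      fromℤ (∏ℤ f T ℤ.* Z) ∎)
      where
      open ≡-Reasoning
      |T|≡N : length T ≡ N
      |T|≡N = interval-length m N
      s≤|T| : s ℕ.≤ length T
      s≤|T| = subst (s ℕ.≤_) (sym |T|≡N) s≤N
      integral : Σ ℤ (λ Z → scale * subsetSum T ≡ ∏ (fromℤ ∘ f) T * fromℤ Z)
      integral = ΣSplit-integral s T summand scale (∏ (fromℤ ∘ f) T) summand-integral
      Z : ℤ
      Z = proj₁ integral
      scale*subsetSum≡ : scale * subsetSum T ≡ ∏ (fromℤ ∘ f) T * fromℤ Z
      scale*subsetSum≡ = proj₂ integral

    -- Taking absolute values in the cleared identity: (LΔ)ˢ |aₛ|^{N−s} = |Z| ∏ |f(T)| with Z ≠ 0.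
    bound-long : s ℕ.≤ N → L ≢ 0 → ∏ℕ ∣f∣ T ℕ.≤ (L ℕ.* Δ) ℕ.^ s ℕ.* ℤ.∣ aₛ ∣ ℕ.^ N
    bound-long s≤N L≢0 = begin
      ∏ℕ ∣f∣ T                                      ≤⟨ ℕP.m≤m*n (∏ℕ ∣f∣ T) ℤ.∣ Z ∣ {{ℕ.≢-nonZero ∣Z∣≢0}} ⟩
      ∏ℕ ∣f∣ T ℕ.* ℤ.∣ Z ∣                          ≡⟨ sym ∣identity∣ ⟩
      (L ℕ.* Δ) ℕ.^ s ℕ.* ℤ.∣ aₛ ∣ ℕ.^ (N ∸ s)      ≤⟨ ℕP.*-monoʳ-≤ ((L ℕ.* Δ) ℕ.^ s) (ℕP.^-monoʳ-≤ ℤ.∣ aₛ ∣ {{∣aₛ∣≢0}} (ℕP.m∸n≤m N s)) ⟩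
      (L ℕ.* Δ) ℕ.^ s ℕ.* ℤ.∣ aₛ ∣ ℕ.^ N ∎
      where
      open ℕP.≤-Reasoning
      Z : ℤ
      Z = proj₁ (cleared-identity s≤N)
      ∣identity∣ : (L ℕ.* Δ) ℕ.^ s ℕ.* ℤ.∣ aₛ ∣ ℕ.^ (N ∸ s) ≡ ∏ℕ ∣f∣ T ℕ.* ℤ.∣ Z ∣
      ∣identity∣ = trans (sym (trans (ℤP.abs-* (+ ((L ℕ.* Δ) ℕ.^ s)) (aₛ ℤ.^ (N ∸ s))) (cong ((L ℕ.* Δ) ℕ.^ s ℕ.*_) (∣^∣ aₛ (N ∸ s)))))
        (trans (cong ℤ.∣_∣ (proj₂ (cleared-identity s≤N))) (trans (ℤP.abs-* (∏ℤ f T) Z) (cong (ℕ._* ℤ.∣ Z ∣) (∣∏ℤ∣ f T))))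
      lhs≢0 : ℕ.NonZero ((L ℕ.* Δ) ℕ.^ s ℕ.* ℤ.∣ aₛ ∣ ℕ.^ (N ∸ s))
      lhs≢0 = ℕP.m*n≢0 _ _ {{ℕP.m^n≢0 (L ℕ.* Δ) s {{ℕP.m*n≢0 L Δ {{ℕ.≢-nonZero L≢0}} {{ℕP._!≢0 (n ∸ m)}}}}}}
                           {{ℕP.m^n≢0 ℤ.∣ aₛ ∣ (N ∸ s) {{∣aₛ∣≢0}}}}
      ∣Z∣≢0 : ℤ.∣ Z ∣ ≢ 0
      ∣Z∣≢0 ∣Z∣≡0 = ℕ.≢-nonZero⁻¹ _ {{lhs≢0}} (trans ∣identity∣ (trans (cong (∏ℕ ∣f∣ T ℕ.*_) ∣Z∣≡0) (ℕP.*-zeroʳ (∏ℕ ∣f∣ T))))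

    -- Fewer than s points: each |f(j)| divides L, so the product is at most Lᴺ ≤ Lˢ.
    bound-short : ¬ (s ℕ.≤ N) → L ≢ 0 → ∏ℕ ∣f∣ T ℕ.≤ (L ℕ.* Δ) ℕ.^ s ℕ.* ℤ.∣ aₛ ∣ ℕ.^ N
    bound-short s≰N L≢0 = begin
      ∏ℕ ∣f∣ T                           ≤⟨ ∏ℕ-≤-^ ∣f∣ T L (All.map (ℕ∣.∣⇒≤ {{ℕ.≢-nonZero L≢0}}) f∣L) ⟩
      L ℕ.^ length T                     ≡⟨ cong (L ℕ.^_) (interval-length m N) ⟩
      L ℕ.^ N                            ≤⟨ ℕP.^-monoʳ-≤ L {{ℕ.≢-nonZero L≢0}} (ℕP.<⇒≤ (ℕP.≰⇒> s≰N)) ⟩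
      L ℕ.^ s                            ≤⟨ ℕP.^-monoˡ-≤ s (ℕP.m≤m*n L Δ {{ℕP._!≢0 (n ∸ m)}}) ⟩
      (L ℕ.* Δ) ℕ.^ s                    ≤⟨ ℕP.m≤m*n _ _ {{ℕP.m^n≢0 ℤ.∣ aₛ ∣ N {{∣aₛ∣≢0}}}} ⟩
      (L ℕ.* Δ) ℕ.^ s ℕ.* ℤ.∣ aₛ ∣ ℕ.^ N ∎
      where open ℕP.≤-Reasoning

    L≢0 : ∏ℕ ∣f∣ T ≢ 0 → L ≢ 0
    L≢0 ∏≢0 = lcmList-≢0 ∣f∣ (range m n) (subst (All (λ j → ∣f∣ j ≢ 0)) (sym range≡T) (∏ℕ-≢0 ∣f∣ T ∏≢0))

    bound : prodAbsVals a m n ℕ.≤ (L ℕ.* Δ) ℕ.^ s ℕ.* ℤ.∣ aₛ ∣ ℕ.^ N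
    bound = subst (ℕ._≤ (L ℕ.* Δ) ℕ.^ s ℕ.* ℤ.∣ aₛ ∣ ℕ.^ N) (cong (∏ℕ ∣f∣) (sym range≡T)) (by-cases (∏ℕ ∣f∣ T ℕP.≟ 0) (s ℕ.≤? N))
      where
      by-cases : Dec (∏ℕ ∣f∣ T ≡ 0) → Dec (s ℕ.≤ N) → ∏ℕ ∣f∣ T ℕ.≤ (L ℕ.* Δ) ℕ.^ s ℕ.* ℤ.∣ aₛ ∣ ℕ.^ N
      by-cases (yes ∏≡0) _ = ℕP.≤-trans (ℕP.≤-reflexive ∏≡0) z≤n
      by-cases (no ∏≢0) (yes s≤N) = bound-long s≤N (L≢0 ∏≢0)
      by-cases (no ∏≢0) (no s≰N) = bound-short s≰N (L≢0 ∏≢0)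

open import Defs
open ProductBound using (module LcmBound)
open import Data.Nat using (ℕ; suc; _*_; _∸_; _^_; _≤_; _!)
open import Data.Integer using (∣_∣; 0ℤ)
open import Data.Fin using (fromℕ)
open import Data.Vec using (lookup)
open import Relation.Binary.PropositionalEquality using (_≢_)

lemma3p1 : (s : ℕ) → 1 ≤ s → (a : Poly s) → lookup a (fromℕ s) ≢ 0ℤ →
    (m n : ℕ) → 1 ≤ m → m ≤ n →
    prodAbsVals a m n
      ≤ ((lcmVals a m n * (n ∸ m) !) ^ s) * (∣ lookup a (fromℕ s) ∣ ^ suc (n ∸ m))
lemma3p1 (suc k) _ a aₛ≢0 m n _ _ = LcmBound.bound k a aₛ≢0 m n
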